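{- There is no Narayana number $N_n$ whose decimal representation consists of a single nonzero digit repeated at least $3$ times. Moreover, the only Narayana number whose decimal representation consists of a single nonzero digit repeated exactly twice is $N_{14}=88$.
   Context: The Narayana sequence $(N_n)_{n\ge0}$ is defined by $N_0=0$, $N_1=N_2=1$ and $N_n=N_{n-1}+N_{n-3}$ for $n\ge 3$. -}

module Defs where

open import Data.Nat using (ℕ; zero; suc; _+_; _*_)

N : ℕ → ℕ
N 0 = 0
N 1 = 1
N 2 = 1
N (suc (suc (suc n))) = N (suc (suc n)) + N n

-- repunit k = 11...1 (k ones in decimal) = (10^k - 1)/9.
repunit : ℕ → ℕ
repunit zero = 0
repunit (suc k) = 1 + 10 * repunit k

repdigit : ℕ → ℕ → ℕ
repdigit d k = d * repunit k

-- Small repdigits (two or three digits) are below N 21 = 1278, and N is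
-- monotone, so they can only occur among N 0, …, N 20: a finite check.
--
-- Repdigits with k ≥ 4 digits are ruled out modulo
--   M = 47051862000 = 2⁴ · 3 · 5³ · 11 · 13 · 29 · 31 · 61.
-- Modulo M the Narayana sequence is purely periodic with period 130200, and
-- for k ≥ 4 the repunits are periodic with period 420 starting from
-- repunit 4 = 1111.  Moreover a repdigit dd…d with at least four digits is
-- ≡ 1111·d (mod 2000), and 2000 ∣ M.  A single evaluation checks that no
-- residue of N modulo M over a full period equals d · R modulo M for a digit d
-- and a repunit residue R of the cycle (the congruence modulo 2000 discards
-- almost all pairs (n, d) at once).

module Submission where

open import Defs
open import Data.Nat using (ℕ; _≤_)
open import Data.Product using (_×_)
open import Relation.Binary.PropositionalEquality using (_≡_; _≢_)
open import Function.Bundles using (_⇔_)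

open import Data.Nat
  using (zero; suc; _+_; _*_; _<_; _%_; _/_; _≡ᵇ_; NonZero; >-nonZero⁻¹; z≤n; s≤s; _≤′_; ≤′-refl; ≤′-step; _<?_)
open import Data.Nat.Properties
  using (+-comm; +-suc; ≤-refl; ≤-trans; m≤m+n; *-monoˡ-≤; ≤⇒≤′; ≤⇒≤ᵇ; ≮⇒≥; ≡ᵇ⇒≡; ≡⇒≡ᵇ)
open import Data.Nat.DivMod using (m≡m%n+[m/n]*n; m%n<n; m<n⇒m%n≡m; [m+kn]%n≡m%n; %-distribˡ-+; m∣n⇒o%n%m≡o%m)
open import Data.Nat.Divisibility using (_∣_; divides)
open import Data.Nat.GeneralisedArithmetic using (iterate; iterate-is-fold; id-is-fold)
open import Data.Nat.Solver using (module +-*-Solver)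
open import Data.Bool using (Bool; true; _∧_; _∨_; not; T)
open import Data.Bool.Properties using (T-∧; T-∨; T-not-≡; T-≡)
open import Data.Product using (_,_; proj₁; proj₂)
open import Data.Sum using (_⊎_; inj₁; inj₂)
open import Data.Empty using (⊥-elim)
open import Function.Base using (_∘_)
open import Function.Bundles using (mk⇔; Equivalence)
open import Relation.Nullary using (yes; no; contradiction)
open import Relation.Binary.PropositionalEquality using (refl; sym; trans; cong; subst; module ≡-Reasoning)

open +-*-Solver using (solve; _:+_; _:*_; _:=_; con)
open Equivalence using (to; from)

private
  variable
    A : Set

iterate-+ : (s : A → A) (x : A) (m n : ℕ) → iterate s x (m + n) ≡ iterate s (iterate s x m) n
iterate-+ s x zero    n = refl
iterate-+ s x (suc m) n = iterate-+ s (s x) m n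

iterate-suc : (s : A → A) (x : A) (n : ℕ) → iterate s x (suc n) ≡ s (iterate s x n)
iterate-suc s x n = trans (cong (iterate s x) (+-comm 1 n)) (iterate-+ s x n 1)

iterate-multiple : (s : A → A) (x : A) (p : ℕ) → iterate s x p ≡ x →
                   (q : ℕ) → iterate s x (q * p) ≡ x
iterate-multiple s x p back zero    = refl
iterate-multiple s x p back (suc q) = begin
  iterate s x (p + q * p)           ≡⟨ iterate-+ s x p (q * p) ⟩
  iterate s (iterate s x p) (q * p) ≡⟨ cong (λ y → iterate s y (q * p)) back ⟩
  iterate s x (q * p)               ≡⟨ iterate-multiple s x p back q ⟩
  x                                 ∎
  where open ≡-Reasoning

iterate-periodic : (s : A → A) (x : A) (p : ℕ) .{{_ : NonZero p}} → iterate s x p ≡ x →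
                   (n : ℕ) → iterate s x n ≡ iterate s x (n % p)
iterate-periodic s x p back n = begin
  iterate s x n                                 ≡⟨ cong (iterate s x) n≡qp+r ⟩
  iterate s x ((n / p) * p + n % p)             ≡⟨ iterate-+ s x ((n / p) * p) (n % p) ⟩
  iterate s (iterate s x ((n / p) * p)) (n % p) ≡⟨ cong (λ y → iterate s y (n % p)) (iterate-multiple s x p back (n / p)) ⟩
  iterate s x (n % p)                           ∎
  where
  open ≡-Reasoning
  n≡qp+r : n ≡ (n / p) * p + n % p
  n≡qp+r = trans (m≡m%n+[m/n]*n n p) (+-comm (n % p) ((n / p) * p))

allOrbit : ℕ → (A → A) → (A → Bool) → A → Bool
allOrbit zero    s test x = true
allOrbit (suc n) s test x = test x ∧ allOrbit n s test (s x)

allOrbit-sound : (n : ℕ) (s : A → A) (test : A → Bool) (x : A) → T (allOrbit n s test x) →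
                 (i : ℕ) → i < n → T (test (iterate s x i))
allOrbit-sound (suc n) s test x ok zero    _         = proj₁ (to T-∧ ok)
allOrbit-sound (suc n) s test x ok (suc i) (s≤s i<n) = allOrbit-sound n s test (s x) (proj₂ (to T-∧ ok)) i i<n

orbit-invariant : (s : A → A) (test : A → Bool) (x : A) (p : ℕ) .{{_ : NonZero p}} →
                  iterate s x p ≡ x → T (allOrbit p s test x) →
                  (n : ℕ) → T (test (iterate s x n))
orbit-invariant s test x p back ok n =
  subst (T ∘ test) (sym (iterate-periodic s x p back n)) (allOrbit-sound p s test x ok (n % p) (m%n<n n p))

every : ℕ → (ℕ → Bool) → Bool
every n test = allOrbit n suc test 0

-- Soundness of `every`: the orbit of 0 under suc enumerates 0, 1, 2, ….
every-sound : (n : ℕ) (test : ℕ → Bool) → T (every n test) → (i : ℕ) → i < n → T (test i)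
every-sound n test ok i i<n = subst (T ∘ test) counts (allOrbit-sound n suc test 0 ok i i<n)
  where
  counts : iterate suc 0 i ≡ i
  counts = trans (sym (iterate-is-fold 0 suc i)) (id-is-fold i)

digits : (ℕ → Bool) → Bool
digits test = every 9 (test ∘ suc)

digits-sound : (test : ℕ → Bool) → T (digits test) → (d : ℕ) → 1 ≤ d → d ≤ 9 → T (test d)
digits-sound test ok (suc d) _ d<9 = every-sound 9 (test ∘ suc) ok d d<9

≢-from-test : {m n : ℕ} → T (not (m ≡ᵇ n)) → m ≢ n
≢-from-test {m} {n} ok m≡n = subst T (to T-not-≡ ok) (≡⇒≡ᵇ m n m≡n)

affine-mod : (a b x m : ℕ) .{{_ : NonZero m}} → (a + b * x) % m ≡ (a + b * (x % m)) % m
affine-mod a b x m = begin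
  (a + b * x) % m                           ≡⟨ cong (λ y → (a + b * y) % m) (m≡m%n+[m/n]*n x m) ⟩
  (a + b * (x % m + (x / m) * m)) % m       ≡⟨ cong (_% m) (regroup a b (x % m) (x / m) m) ⟩
  (a + b * (x % m) + (b * (x / m)) * m) % m ≡⟨ [m+kn]%n≡m%n (a + b * (x % m)) (b * (x / m)) m ⟩
  (a + b * (x % m)) % m                     ∎
  where
  open ≡-Reasoning
  regroup : (a b r q m : ℕ) → a + b * (r + q * m) ≡ a + b * r + (b * q) * m
  regroup = solve 5 (λ a b r q m → a :+ b :* (r :+ q :* m) := a :+ b :* r :+ (b :* q) :* m) refl

Window : Set
Window = ℕ × ℕ × ℕ

window : (m : ℕ) .{{_ : NonZero m}} → ℕ → Window
window m n = N n % m , N (suc n) % m , N (suc (suc n)) % m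

narayanaStep : (m : ℕ) .{{_ : NonZero m}} → Window → Window
narayanaStep m (a , b , c) = b , c , (c + a) % m

window-orbit : (m : ℕ) .{{_ : NonZero m}} (n : ℕ) → iterate (narayanaStep m) (window m 0) n ≡ window m n
window-orbit m n = trans (shift n 0) (cong (window m) (+-comm n 0))
  where
  advance : (k : ℕ) → narayanaStep m (window m k) ≡ window m (suc k)
  advance k = cong (λ z → N (suc k) % m , N (suc (suc k)) % m , z)
                   (sym (%-distribˡ-+ (N (suc (suc k))) (N k) m))
  shift : (n k : ℕ) → iterate (narayanaStep m) (window m k) n ≡ window m (n + k)
  shift zero    k = refl
  shift (suc n) k = begin
    iterate (narayanaStep m) (narayanaStep m (window m k)) n ≡⟨ cong (λ w → iterate (narayanaStep m) w n) (advance k) ⟩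
    iterate (narayanaStep m) (window m (suc k)) n            ≡⟨ shift n (suc k) ⟩
    window m (n + suc k)                                     ≡⟨ cong (window m) (+-suc n k) ⟩
    window m (suc n + k)                                     ∎
    where open ≡-Reasoning

repunitStep : (m : ℕ) .{{_ : NonZero m}} → ℕ → ℕ
repunitStep m x = (1 + 10 * x) % m

repunit-orbit : (m : ℕ) .{{_ : NonZero m}} (k : ℕ) → iterate (repunitStep m) 0 k ≡ repunit k % m
repunit-orbit m zero    = sym (m<n⇒m%n≡m (>-nonZero⁻¹ m))
repunit-orbit m (suc k) = begin
  iterate (repunitStep m) 0 (suc k)           ≡⟨ iterate-suc (repunitStep m) 0 k ⟩
  repunitStep m (iterate (repunitStep m) 0 k) ≡⟨ cong (repunitStep m) (repunit-orbit m k) ⟩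
  (1 + 10 * (repunit k % m)) % m              ≡⟨ affine-mod 1 10 (repunit k) m ⟨
  repunit (suc k) % m                         ∎
  where open ≡-Reasoning

repunit-4+ : (j : ℕ) → repunit (4 + j) ≡ 1111 + 10000 * repunit j
repunit-4+ zero    = refl
repunit-4+ (suc j) = begin
  1 + 10 * repunit (4 + j)            ≡⟨ cong (λ r → 1 + 10 * r) (repunit-4+ j) ⟩
  1 + 10 * (1111 + 10000 * repunit j) ≡⟨ shift (repunit j) ⟩
  1111 + 10000 * (1 + 10 * repunit j) ∎
  where
  open ≡-Reasoning
  shift : (r : ℕ) → 1 + 10 * (1111 + 10000 * r) ≡ 1111 + 10000 * (1 + 10 * r)
  shift = solve 1 (λ r → con 1 :+ con 10 :* (con 1111 :+ con 10000 :* r)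
                       := con 1111 :+ con 10000 :* (con 1 :+ con 10 :* r)) refl

long-repdigit-mod-2000 : (d j : ℕ) → repdigit d (4 + j) % 2000 ≡ (d * 1111) % 2000
long-repdigit-mod-2000 d j = begin
  (d * repunit (4 + j)) % 2000                   ≡⟨ cong (λ r → (d * r) % 2000) (repunit-4+ j) ⟩
  (d * (1111 + 10000 * repunit j)) % 2000        ≡⟨ cong (_% 2000) (split d (repunit j)) ⟩
  (d * 1111 + (5 * d * repunit j) * 2000) % 2000 ≡⟨ [m+kn]%n≡m%n (d * 1111) (5 * d * repunit j) 2000 ⟩
  (d * 1111) % 2000                              ∎
  where
  open ≡-Reasoning
  split : (d r : ℕ) → d * (1111 + 10000 * r) ≡ d * 1111 + (5 * d * r) * 2000
  split = solve 2 (λ d r → d :* (con 1111 :+ con 10000 :* r)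
                         := d :* con 1111 :+ (con 5 :* d :* r) :* con 2000) refl

N-step : (n : ℕ) → N n ≤ N (suc n)
N-step zero          = z≤n
N-step (suc zero)    = ≤-refl
N-step (suc (suc n)) = m≤m+n (N (suc (suc n))) (N n)

N-monotone : {m n : ℕ} → m ≤ n → N m ≤ N n
N-monotone m≤n = go (≤⇒≤′ m≤n)
  where
  go : {m n : ℕ} → m ≤′ n → N m ≤ N n
  go ≤′-refl        = ≤-refl
  go {n = suc n} (≤′-step m≤′n) = ≤-trans (go m≤′n) (N-step n)

N-small-index : (n : ℕ) → N n ≤ 999 → n < 21
N-small-index n bound with n <? 21
... | yes n<21 = n<21
... | no  n≮21 = ⊥-elim (≤⇒≤ᵇ (≤-trans (N-monotone (≮⇒≥ n≮21)) bound))

three-digit-test : ℕ → ℕ → Bool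
three-digit-test n d = not (N n ≡ᵇ repdigit d 3)

two-digit-test : ℕ → ℕ → Bool
two-digit-test n d = not (N n ≡ᵇ repdigit d 2) ∨ ((n ≡ᵇ 14) ∧ (d ≡ᵇ 8))

three-digit-check : every 21 (digits ∘ three-digit-test) ≡ true
three-digit-check = refl

two-digit-check : every 21 (digits ∘ two-digit-test) ≡ true
two-digit-check = refl

no-three-digit-repdigit : (n d : ℕ) → 1 ≤ d → d ≤ 9 → N n ≢ repdigit d 3
no-three-digit-repdigit n d 1≤d d≤9 eq = ≢-from-test at-n-d eq
  where
  n<21 : n < 21
  n<21 = N-small-index n (subst (_≤ 999) (sym eq) (*-monoˡ-≤ 111 d≤9))
  at-n-d : T (three-digit-test n d)
  at-n-d = digits-sound (three-digit-test n)
             (every-sound 21 (digits ∘ three-digit-test) (from T-≡ three-digit-check) n n<21) d 1≤d d≤9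

two-digit-repdigit : (n d : ℕ) → 1 ≤ d → d ≤ 9 → N n ≡ repdigit d 2 → n ≡ 14 × d ≡ 8
two-digit-repdigit n d 1≤d d≤9 eq = conclude (to T-∨ at-n-d)
  where
  n<21 : n < 21
  n<21 = N-small-index n (subst (_≤ 999) (sym eq) (≤-trans (*-monoˡ-≤ 11 d≤9) (m≤m+n 99 900)))
  at-n-d : T (two-digit-test n d)
  at-n-d = digits-sound (two-digit-test n)
             (every-sound 21 (digits ∘ two-digit-test) (from T-≡ two-digit-check) n n<21) d 1≤d d≤9
  conclude : T (not (N n ≡ᵇ repdigit d 2)) ⊎ T ((n ≡ᵇ 14) ∧ (d ≡ᵇ 8)) → n ≡ 14 × d ≡ 8
  conclude (inj₁ differs)  = contradiction eq (≢-from-test differs)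
  conclude (inj₂ 14-and-8) = ≡ᵇ⇒≡ n 14 (proj₁ (to T-∧ 14-and-8)) , ≡ᵇ⇒≡ d 8 (proj₂ (to T-∧ 14-and-8))

M : ℕ
M = 47051862000

2000∣M : 2000 ∣ M
2000∣M = divides 23525931 refl

narayana-period : iterate (narayanaStep M) (window M 0) 130200 ≡ window M 0
narayana-period = refl

repunit-period : iterate (repunitStep M) 1111 420 ≡ 1111
repunit-period = refl

misses : ℕ → ℕ → ℕ → Bool
misses a d r = not ((d * r) % M ≡ᵇ a)

avoidsFor : ℕ → ℕ → Bool
avoidsFor a d = not (a % 2000 ≡ᵇ (d * 1111) % 2000) ∨ allOrbit 420 (repunitStep M) (misses a d) 1111

avoidsLongRepdigits : ℕ → Bool
avoidsLongRepdigits a = digits (avoidsFor a)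

residues-check : allOrbit 130200 (narayanaStep M) (avoidsLongRepdigits ∘ proj₁) (window M 0) ≡ true
residues-check = refl

N-avoids : (n : ℕ) → T (avoidsLongRepdigits (N n % M))
N-avoids n = subst (T ∘ avoidsLongRepdigits) N-mod-M
  (orbit-invariant (narayanaStep M) (avoidsLongRepdigits ∘ proj₁) (window M 0) 130200
                   narayana-period (from T-≡ residues-check) n)
  where
  N-mod-M : proj₁ (iterate (narayanaStep M) (window M 0) n) ≡ N n % M
  N-mod-M = cong proj₁ (window-orbit M n)

no-long-repdigit : (n d j : ℕ) → 1 ≤ d → d ≤ 9 → N n ≢ repdigit d (4 + j)
no-long-repdigit n d j 1≤d d≤9 eq with to T-∨ (digits-sound (avoidsFor (N n % M)) (N-avoids n) d 1≤d d≤9)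
... | inj₁ not-candidate = ≢-from-test not-candidate candidate
  where
  candidate : N n % M % 2000 ≡ (d * 1111) % 2000
  candidate = begin
    N n % M % 2000            ≡⟨ m∣n⇒o%n%m≡o%m 2000 M (N n) 2000∣M ⟩
    N n % 2000                ≡⟨ cong (_% 2000) eq ⟩
    repdigit d (4 + j) % 2000 ≡⟨ long-repdigit-mod-2000 d j ⟩
    (d * 1111) % 2000         ∎
    where open ≡-Reasoning
... | inj₂ cycle-avoids = ≢-from-test (orbit-invariant (repunitStep M) (misses (N n % M) d) 1111 420 repunit-period cycle-avoids j) hit
  where
  hit : (d * iterate (repunitStep M) 1111 j) % M ≡ N n % M
  hit = begin
    (d * iterate (repunitStep M) 1111 j) % M    ≡⟨ cong (λ r → (d * r) % M) (iterate-+ (repunitStep M) 0 4 j) ⟨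
    (d * iterate (repunitStep M) 0 (4 + j)) % M ≡⟨ cong (λ r → (d * r) % M) (repunit-orbit M (4 + j)) ⟩
    (d * (repunit (4 + j) % M)) % M             ≡⟨ affine-mod 0 d (repunit (4 + j)) M ⟨
    repdigit d (4 + j) % M                      ≡⟨ cong (_% M) eq ⟨
    N n % M                                     ∎
    where open ≡-Reasoning

mainTheorem8 :
    ((n d k : ℕ) → 1 ≤ d → d ≤ 9 → 3 ≤ k → N n ≢ repdigit d k)
    × ((n d : ℕ) → 1 ≤ d → d ≤ 9 → (N n ≡ repdigit d 2 ⇔ (n ≡ 14 × d ≡ 8)))
mainTheorem8 = no-repdigit , λ n d 1≤d d≤9 → mk⇔ (two-digit-repdigit n d 1≤d d≤9) only-88
  where
  no-repdigit : (n d k : ℕ) → 1 ≤ d → d ≤ 9 → 3 ≤ k → N n ≢ repdigit d k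
  no-repdigit n d 3                         1≤d d≤9 _ = no-three-digit-repdigit n d 1≤d d≤9
  no-repdigit n d (suc (suc (suc (suc j)))) 1≤d d≤9 _ = no-long-repdigit n d j 1≤d d≤9
  no-repdigit n d 0 _ _ ()
  no-repdigit n d 1 _ _ (s≤s ())
  no-repdigit n d 2 _ _ (s≤s (s≤s ()))
  only-88 : {n d : ℕ} → n ≡ 14 × d ≡ 8 → N n ≡ repdigit d 2
  only-88 (refl , refl) = refl
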